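{- Let $\mathcal Q$ be a quasivariety of $\mathsf{FL}_w$-algebras in which, for every algebra of $\mathcal Q$, every principal congruence is a factor congruence. Then $\mathcal Q$ has projective unifiers.
   Context: An $\mathsf{FL}_w$-algebra is $(A,\vee,\wedge,\cdot,\backslash,/,1,0)$ with $(A,\vee,\wedge)$ a lattice, $(A,\cdot,1)$ a monoid, $x\cdot y\le z$ iff $y\le x\backslash z$ iff $x\le z/y$, and $0\le x\le 1$ for all $x$. A congruence $\theta$ of $\mathbf A$ is a factor congruence if there is a congruence $\theta'$ with $\theta\vee\theta'=1_{\mathbf A}$, $\theta\wedge\theta'=0_{\mathbf A}$ and $\theta,\theta'$ permuting. For a quasivariety $\mathcal Q$, an algebra is finitely presented if isomorphic to $\mathbf F_{\mathcal Q}(X)/\theta_{\mathcal Q}(H)$ ($X,H$ finite, $\mathbf F_{\mathcal Q}(X)$ the free algebra, $\theta_{\mathcal Q}(H)$ the least congruence containing $H$ with quotient in $\mathcal Q$); it is unifiable if it has a homomorphism into a projective algebra of $\mathcal Q$ (equivalently into the smallest free algebra $\mathbf F_{\mathcal Q}=\mathbf F_{\mathcal Q}(\emptyset)$). $\mathcal Q$ has projective unifiers if every finitely presented unifiable algebra in $\mathcal Q$ is projective in $\mathcal Q$. -}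

module Defs where

open import Level using (Level; _⊔_; 0ℓ; Setω) renaming (suc to lsuc)
open import Data.Nat using (ℕ)
open import Data.Fin using (Fin)
open import Data.List using (List; [])
open import Data.List.Membership.Propositional using (_∈_)
open import Data.Product using (Σ; ∃; _×_; _,_; proj₁; proj₂)
open import Data.Sum using (_⊎_)
open import Relation.Binary using (Rel; IsEquivalence)

data BinOp : Set where
  join meet mul ldiv rdiv : BinOp

data Const : Set where
  one zero : Const

data Term (n : ℕ) : Set where
  var : Fin n → Term n
  bin : BinOp → Term n → Term n → Term n
  con : Const → Term n

sub : ∀ {m n} → (Fin m → Term n) → Term m → Term n
sub σ (var x)     = σ x
sub σ (bin o s t) = bin o (sub σ s) (sub σ t)
sub σ (con k)     = con k

Eqn : ℕ → Set
Eqn n = Term n × Term n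

-- A quasi-identity  s₁ ≈ t₁ & ... & sₖ ≈ tₖ ⇒ s ≈ t  in m variables
QId : Set
QId = Σ ℕ λ m → List (Eqn m) × Eqn m

-- Algebras of the signature, over a setoid (quotients are setoids)

record Alg (c ℓ : Level) : Set (lsuc (c ⊔ ℓ)) where
  field
    Carrier : Set c
    _≈_     : Rel Carrier ℓ
    isEquiv : IsEquivalence _≈_
    op      : BinOp → Carrier → Carrier → Carrier
    cst     : Const → Carrier
    op-cong : ∀ o {x y u v} → x ≈ y → u ≈ v → op o x u ≈ op o y v

open Alg public

eval : ∀ {c ℓ n} (A : Alg c ℓ) → (Fin n → Carrier A) → Term n → Carrier A
eval A v (var x)     = v x
eval A v (bin o s t) = op A o (eval A v s) (eval A v t)
eval A v (con k)     = cst A k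

Holds : ∀ {c ℓ} → Alg c ℓ → QId → Set (c ⊔ ℓ)
Holds A (m , prem , (s , t)) =
  (v : Fin m → Carrier A) →
  (∀ {e} → e ∈ prem → _≈_ A (eval A v (proj₁ e)) (eval A v (proj₂ e))) →
  _≈_ A (eval A v s) (eval A v t)

private
  x₀ : Term 3
  x₀ = var Fin.zero
    where import Data.Fin as Fin
  y₀ : Term 3
  y₀ = var (Fin.suc Fin.zero)
    where import Data.Fin as Fin
  z₀ : Term 3
  z₀ = var (Fin.suc (Fin.suc Fin.zero))
    where import Data.Fin as Fin

_≤ₜ_ : Term 3 → Term 3 → Eqn 3
s ≤ₜ t = (bin meet s t , s)

infix 4 _≈ₜ_
_≈ₜ_ : Term 3 → Term 3 → Eqn 3
s ≈ₜ t = (s , t)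

eq : Eqn 3 → QId
eq e = (3 , [] , e)

imp : Eqn 3 → Eqn 3 → QId
imp p e = (3 , p Data.List.∷ [] , e)
  where import Data.List

data FLwAx : QId → Set where
  ∨-assoc : FLwAx (eq (bin join (bin join x₀ y₀) z₀ ≈ₜ bin join x₀ (bin join y₀ z₀)))
  ∧-assoc : FLwAx (eq (bin meet (bin meet x₀ y₀) z₀ ≈ₜ bin meet x₀ (bin meet y₀ z₀)))
  ∨-comm  : FLwAx (eq (bin join x₀ y₀ ≈ₜ bin join y₀ x₀))
  ∧-comm  : FLwAx (eq (bin meet x₀ y₀ ≈ₜ bin meet y₀ x₀))
  ∨-absorb : FLwAx (eq (bin join x₀ (bin meet x₀ y₀) ≈ₜ x₀))
  ∧-absorb : FLwAx (eq (bin meet x₀ (bin join x₀ y₀) ≈ₜ x₀))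
  ·-assoc : FLwAx (eq (bin mul (bin mul x₀ y₀) z₀ ≈ₜ bin mul x₀ (bin mul y₀ z₀)))
  ·-idˡ   : FLwAx (eq (bin mul (con one) x₀ ≈ₜ x₀))
  ·-idʳ   : FLwAx (eq (bin mul x₀ (con one) ≈ₜ x₀))
  res₁ : FLwAx (imp (bin mul x₀ y₀ ≤ₜ z₀) (y₀ ≤ₜ bin ldiv x₀ z₀))
  res₂ : FLwAx (imp (y₀ ≤ₜ bin ldiv x₀ z₀) (bin mul x₀ y₀ ≤ₜ z₀))
  res₃ : FLwAx (imp (bin mul x₀ y₀ ≤ₜ z₀) (x₀ ≤ₜ bin rdiv z₀ y₀))
  res₄ : FLwAx (imp (x₀ ≤ₜ bin rdiv z₀ y₀) (bin mul x₀ y₀ ≤ₜ z₀))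
  bot : FLwAx (eq (con zero ≤ₜ x₀))
  top : FLwAx (eq (x₀ ≤ₜ con one))

-- A quasivariety of FL_w-algebras: the class of algebras satisfying the
-- FL_w axioms together with a set Γ of quasi-identities.

Axioms : (QId → Set) → QId → Set
Axioms Γ q = FLwAx q ⊎ Γ q

InQ : ∀ {c ℓ} → (QId → Set) → Alg c ℓ → Set (c ⊔ ℓ)
InQ Γ A = ∀ {q} → Axioms Γ q → Holds A q

record Hom {a α b β} (A : Alg a α) (B : Alg b β) : Set (a ⊔ α ⊔ b ⊔ β) where
  field
    fun     : Carrier A → Carrier B
    fun-cong : ∀ {x y} → _≈_ A x y → _≈_ B (fun x) (fun y)
    fun-op  : ∀ o x y → _≈_ B (fun (op A o x y)) (op B o (fun x) (fun y))
    fun-cst : ∀ k → _≈_ B (fun (cst A k)) (cst B k)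

open Hom public

Surjective : ∀ {a α b β} {A : Alg a α} {B : Alg b β} → Hom A B → Set (a ⊔ b ⊔ β)
Surjective {A = A} {B} g = ∀ y → ∃ λ x → _≈_ B (fun g x) y

module _ {c ℓ} (A : Alg c ℓ) where

  record IsCongruence {r} (θ : Rel (Carrier A) r) : Set (c ⊔ ℓ ⊔ r) where
    field
      ≈⇒θ   : ∀ {x y} → _≈_ A x y → θ x y
      θ-sym   : ∀ {x y} → θ x y → θ y x
      θ-trans : ∀ {x y z} → θ x y → θ y z → θ x z
      θ-op    : ∀ o {x y u v} → θ x y → θ u v → θ (op A o x u) (op A o y v)

  data Cg (a b : Carrier A) : Rel (Carrier A) (c ⊔ ℓ) where
    cg-base  : Cg a b a b
    cg-≈     : ∀ {x y} → _≈_ A x y → Cg a b x y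
    cg-sym   : ∀ {x y} → Cg a b x y → Cg a b y x
    cg-trans : ∀ {x y z} → Cg a b x y → Cg a b y z → Cg a b x z
    cg-op    : ∀ o {x y u v} → Cg a b x y → Cg a b u v → Cg a b (op A o x u) (op A o y v)

  data JoinC {r s} (θ : Rel (Carrier A) r) (φ : Rel (Carrier A) s) :
             Rel (Carrier A) (c ⊔ r ⊔ s) where
    inl : ∀ {x y} → θ x y → JoinC θ φ x y
    inr : ∀ {x y} → φ x y → JoinC θ φ x y
    step : ∀ {x y z} → JoinC θ φ x y → JoinC θ φ y z → JoinC θ φ x z

  _∘ᵣ_ : ∀ {r s} → Rel (Carrier A) r → Rel (Carrier A) s → Rel (Carrier A) (c ⊔ r ⊔ s)
  (θ ∘ᵣ φ) x y = ∃ λ z → θ x z × φ z y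

  -- θ is a factor congruence: it has a permuting complement
  IsFactor : ∀ {r} → Rel (Carrier A) r → Set (lsuc (c ⊔ ℓ) ⊔ r)
  IsFactor θ = Σ (Rel (Carrier A) (c ⊔ ℓ)) λ θ' →
      IsCongruence θ'
    × (∀ x y → JoinC θ θ' x y)
    × (∀ x y → θ x y → θ' x y → _≈_ A x y)
    × (∀ x y → (θ ∘ᵣ θ') x y → (θ' ∘ᵣ θ) x y)
    × (∀ x y → (θ' ∘ᵣ θ) x y → (θ ∘ᵣ θ') x y)

-- Finitely presented algebras  F_Q(X)/θ_Q(H)  with X = Fin n:
-- terms modulo the least congruence containing H closed under the
-- (quasi-)identities of Q.

module _ (Γ : QId → Set) {n : ℕ} (H : List (Eqn n)) where

  data ThQ : Rel (Term n) 0ℓ where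
    hyp   : ∀ {s t} → (s , t) ∈ H → ThQ s t
    th-refl  : ∀ {s} → ThQ s s
    th-sym   : ∀ {s t} → ThQ s t → ThQ t s
    th-trans : ∀ {s t u} → ThQ s t → ThQ t u → ThQ s u
    th-op    : ∀ o {s t u v} → ThQ s t → ThQ u v → ThQ (bin o s u) (bin o t v)
    th-ax    : ∀ {m prem l r} → Axioms Γ (m , prem , (l , r)) →
               (σ : Fin m → Term n) →
               (∀ {e} → e ∈ prem → ThQ (sub σ (proj₁ e)) (sub σ (proj₂ e))) →
               ThQ (sub σ l) (sub σ r)

FP : (Γ : QId → Set) (n : ℕ) → List (Eqn n) → Alg 0ℓ 0ℓ
FP Γ n H = record
  { Carrier = Term n
  ; _≈_ = ThQ Γ H
  ; isEquiv = record { refl = th-refl ; sym = th-sym ; trans = th-trans }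
  ; op = bin
  ; cst = con
  ; op-cong = th-op
  }

FreeQ : (Γ : QId → Set) → Alg 0ℓ 0ℓ
FreeQ Γ = FP Γ 0 []

Projective : (Γ : QId → Set) → ∀ {p π} → Alg p π → Setω
Projective Γ P = ∀ {b β c γ} (B : Alg b β) (C : Alg c γ) →
  InQ Γ B → InQ Γ C →
  (g : Hom B C) → Surjective g → (f : Hom P C) →
  Σ (Hom P B) λ h → ∀ x → _≈_ C (fun g (fun h x)) (fun f x)

Unifiable : (Γ : QId → Set) → ∀ {a α} → Alg a α → Set (a ⊔ α)
Unifiable Γ A = Hom A (FreeQ Γ)

HasProjectiveUnifiers : (QId → Set) → Setω
HasProjectiveUnifiers Γ = ∀ (n : ℕ) (H : List (Eqn n)) →
  Unifiable Γ (FP Γ n H) → Projective Γ (FP Γ n H)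

PrincipalFactor : (QId → Set) → Setω
PrincipalFactor Γ = ∀ {c ℓ} (A : Alg c ℓ) → InQ Γ A →
  (a b : Carrier A) → IsFactor A (Cg A a b)

-- Let F be the free algebra over the variables of a finite presentation H, and let a be the meet
-- of the biresiduals s\t ∧ t\s over the equations s ≈ t of H.  The principal congruence
-- θ = Cg(a, 1) of F contains H and is contained in the congruence presented by H; by hypothesis it
-- has a permuting complement θ'.  Given a unifier c of H, every variable x satisfies
-- x θ z θ' c(x) for some term z, and σ(x) := z is again a unifier: σ(s) and σ(t) are θ-related
-- through s θ t, and θ'-related through c(s) = c(t).  Since moreover σ(x) ≡ x modulo H, σ exhibits
-- F/H as a retract of F, hence as a projective algebra.
{-# OPTIONS --safe #-}
module Submission where

open import Defs
open import Level using (0ℓ)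
open import Data.Nat using (ℕ)
open import Data.Fin using (Fin) renaming (zero to fzero; suc to fsuc)
open import Data.List using (List; []; _∷_)
open import Data.List.Membership.Propositional using (_∈_)
open import Data.List.Relation.Unary.Any using (here; there)
open import Data.Product using (∃; _×_; _,_; proj₁; proj₂)
open import Data.Sum using (inj₁)
open import Function using (_∘_)
open import Relation.Binary using (Rel; Setoid; IsEquivalence)
open import Relation.Binary.PropositionalEquality
  using (_≡_; refl; sym; trans; cong; cong₂; subst; subst₂)
import Relation.Binary.Reasoning.Setoid as SetoidReasoning

algSetoid : ∀ {c ℓ} → Alg c ℓ → Setoid c ℓ
algSetoid A = record { isEquivalence = isEquiv A }

module _ {c ℓ} (A : Alg c ℓ) where

  ≈-refl : ∀ {x} → _≈_ A x x
  ≈-refl = IsEquivalence.refl (isEquiv A)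

  ≈-sym : ∀ {x y} → _≈_ A x y → _≈_ A y x
  ≈-sym = IsEquivalence.sym (isEquiv A)

  ≈-trans : ∀ {x y z} → _≈_ A x y → _≈_ A y z → _≈_ A x z
  ≈-trans = IsEquivalence.trans (isEquiv A)

  eval-cong : ∀ {n} {v w : Fin n → Carrier A} → (∀ i → _≈_ A (v i) (w i)) →
              ∀ t → _≈_ A (eval A v t) (eval A w t)
  eval-cong v≈w (var i)     = v≈w i
  eval-cong v≈w (bin o s t) = op-cong A o (eval-cong v≈w s) (eval-cong v≈w t)
  eval-cong v≈w (con k)     = ≈-refl

  eval-sub : ∀ {m n} (w : Fin n → Carrier A) (σ : Fin m → Term n) t →
             eval A w (sub σ t) ≡ eval A (eval A w ∘ σ) t
  eval-sub w σ (var x)     = refl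
  eval-sub w σ (bin o s t) = cong₂ (op A o) (eval-sub w σ s) (eval-sub w σ t)
  eval-sub w σ (con k)     = refl

hom-eval : ∀ {a α b β n} {A : Alg a α} {B : Alg b β} (f : Hom A B) (v : Fin n → Carrier A) t →
           _≈_ B (fun f (eval A v t)) (eval B (fun f ∘ v) t)
hom-eval {B = B} f v (var x)     = ≈-refl B
hom-eval {B = B} f v (bin o s t) =
  ≈-trans B (fun-op f o _ _) (op-cong B o (hom-eval f v s) (hom-eval f v t))
hom-eval         f v (con k)     = fun-cst f k

sub-var : ∀ {n} (t : Term n) → sub var t ≡ t
sub-var (var x)     = refl
sub-var (bin o s t) = cong₂ (bin o) (sub-var s) (sub-var t)
sub-var (con k)     = refl

sub-sub : ∀ {k m n} (τ : Fin m → Term n) (σ : Fin k → Term m) t →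
          sub τ (sub σ t) ≡ sub (sub τ ∘ σ) t
sub-sub τ σ (var x)     = refl
sub-sub τ σ (bin o s t) = cong₂ (bin o) (sub-sub τ σ s) (sub-sub τ σ t)
sub-sub τ σ (con k)     = refl

eval-FP : ∀ Γ {n m} (H : List (Eqn n)) (v : Fin m → Term n) t → eval (FP Γ n H) v t ≡ sub v t
eval-FP Γ H v (var x)     = refl
eval-FP Γ H v (bin o s t) = cong₂ (bin o) (eval-FP Γ H v s) (eval-FP Γ H v t)
eval-FP Γ H v (con k)     = refl

eval-FP-var : ∀ Γ {n} (H : List (Eqn n)) t → eval (FP Γ n H) var t ≡ t
eval-FP-var Γ H t = trans (eval-FP Γ H var t) (sub-var t)

module _ {c ℓ} (A : Alg c ℓ) where

  Cg-isCongruence : ∀ a b → IsCongruence A (Cg A a b)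
  Cg-isCongruence a b = record { ≈⇒θ = cg-≈ ; θ-sym = cg-sym ; θ-trans = cg-trans ; θ-op = cg-op }

  module _ {r} {θ : Rel (Carrier A) r} (θ-cong : IsCongruence A θ) where
    open IsCongruence θ-cong

    congruenceSetoid : Setoid c r
    congruenceSetoid = record
      { _≈_ = θ
      ; isEquivalence = record { refl = ≈⇒θ (≈-refl A) ; sym = θ-sym ; trans = θ-trans }
      }

    Cg-least : ∀ {a b} → θ a b → ∀ {x y} → Cg A a b x y → θ x y
    Cg-least θab cg-base        = θab
    Cg-least θab (cg-≈ x≈y)     = ≈⇒θ x≈y
    Cg-least θab (cg-sym p)     = θ-sym (Cg-least θab p)
    Cg-least θab (cg-trans p q) = θ-trans (Cg-least θab p) (Cg-least θab q)
    Cg-least θab (cg-op o p q)  = θ-op o (Cg-least θab p) (Cg-least θab q)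

  join⇒composite : ∀ {r s} {θ : Rel (Carrier A) r} {φ : Rel (Carrier A) s} →
                   IsCongruence A θ → IsCongruence A φ →
                   (∀ x y → _∘ᵣ_ A φ θ x y → _∘ᵣ_ A θ φ x y) →
                   ∀ {x y} → JoinC A θ φ x y → _∘ᵣ_ A θ φ x y
  join⇒composite θ-cong φ-cong φθ⊆θφ (inl xθy) = _ , xθy , IsCongruence.≈⇒θ φ-cong (≈-refl A)
  join⇒composite θ-cong φ-cong φθ⊆θφ (inr xφy) = _ , IsCongruence.≈⇒θ θ-cong (≈-refl A) , xφy
  join⇒composite θ-cong φ-cong φθ⊆θφ (step p q)
    with join⇒composite θ-cong φ-cong φθ⊆θφ p | join⇒composite θ-cong φ-cong φθ⊆θφ q
  ... | _ , xθu , uφy | _ , yθv , vφz with φθ⊆θφ _ _ (_ , uφy , yθv)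
  ... | w , uθw , wφv =
    w , IsCongruence.θ-trans θ-cong xθu uθw , IsCongruence.θ-trans φ-cong wφv vφz

module _ (Γ : QId → Set) where

  ThQ-sub : ∀ {m n} {H₁ : List (Eqn m)} {H₂ : List (Eqn n)} (τ : Fin m → Term n) →
            (∀ {s t} → (s , t) ∈ H₁ → ThQ Γ H₂ (sub τ s) (sub τ t)) →
            ∀ {x y} → ThQ Γ H₁ x y → ThQ Γ H₂ (sub τ x) (sub τ y)
  ThQ-sub τ τH (hyp p)        = τH p
  ThQ-sub τ τH th-refl        = th-refl
  ThQ-sub τ τH (th-sym p)     = th-sym (ThQ-sub τ τH p)
  ThQ-sub τ τH (th-trans p q) = th-trans (ThQ-sub τ τH p) (ThQ-sub τ τH q)
  ThQ-sub τ τH (th-op o p q)  = th-op o (ThQ-sub τ τH p) (ThQ-sub τ τH q)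
  ThQ-sub {H₂ = H₂} τ τH (th-ax {l = l} {r} ax σ ps) =
    subst₂ (ThQ Γ H₂) (sym (sub-sub τ σ l)) (sym (sub-sub τ σ r))
      (th-ax ax (sub τ ∘ σ) λ {e} e∈ →
        subst₂ (ThQ Γ H₂) (sub-sub τ σ (proj₁ e)) (sub-sub τ σ (proj₂ e)) (ThQ-sub τ τH (ps e∈)))

  ThQ-weaken : ∀ {n} {H : List (Eqn n)} {x y} → ThQ Γ [] x y → ThQ Γ H x y
  ThQ-weaken (hyp ())
  ThQ-weaken th-refl         = th-refl
  ThQ-weaken (th-sym p)      = th-sym (ThQ-weaken p)
  ThQ-weaken (th-trans p q)  = th-trans (ThQ-weaken p) (ThQ-weaken q)
  ThQ-weaken (th-op o p q)   = th-op o (ThQ-weaken p) (ThQ-weaken q)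
  ThQ-weaken (th-ax ax σ ps) = th-ax ax σ (ThQ-weaken ∘ ps)

  ThQ-isCongruence : ∀ {n} (H : List (Eqn n)) → IsCongruence (FP Γ n []) (ThQ Γ H)
  ThQ-isCongruence H = record
    { ≈⇒θ = ThQ-weaken ; θ-sym = th-sym ; θ-trans = th-trans ; θ-op = th-op }

  ThQ-sound : ∀ {c ℓ n} (B : Alg c ℓ) → InQ Γ B → (w : Fin n → Carrier B) →
              ∀ {x y} → ThQ Γ [] x y → _≈_ B (eval B w x) (eval B w y)
  ThQ-sound B B∈Q w (hyp ())
  ThQ-sound B B∈Q w th-refl        = ≈-refl B
  ThQ-sound B B∈Q w (th-sym p)     = ≈-sym B (ThQ-sound B B∈Q w p)
  ThQ-sound B B∈Q w (th-trans p q) = ≈-trans B (ThQ-sound B B∈Q w p) (ThQ-sound B B∈Q w q)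
  ThQ-sound B B∈Q w (th-op o p q)  = op-cong B o (ThQ-sound B B∈Q w p) (ThQ-sound B B∈Q w q)
  ThQ-sound B B∈Q w (th-ax {prem = prem} {l} {r} ax σ ps) = begin
    eval B w (sub σ l)      ≡⟨ eval-sub B w σ l ⟩
    eval B (eval B w ∘ σ) l ≈⟨ B∈Q ax (eval B w ∘ σ) premises ⟩
    eval B (eval B w ∘ σ) r ≡⟨ eval-sub B w σ r ⟨
    eval B w (sub σ r)      ∎
    where
    open SetoidReasoning (algSetoid B)
    premises : ∀ {e} → e ∈ prem →
               _≈_ B (eval B (eval B w ∘ σ) (proj₁ e)) (eval B (eval B w ∘ σ) (proj₂ e))
    premises {s , t} e∈ = begin
      eval B (eval B w ∘ σ) s ≡⟨ eval-sub B w σ s ⟨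
      eval B w (sub σ s)      ≈⟨ ThQ-sound B B∈Q w (ps e∈) ⟩
      eval B w (sub σ t)      ≡⟨ eval-sub B w σ t ⟩
      eval B (eval B w ∘ σ) t ∎

  FP-inQ : ∀ n (H : List (Eqn n)) → InQ Γ (FP Γ n H)
  FP-inQ n H {m , prem , (l , r)} ax v ps =
    subst₂ (ThQ Γ H) (sym (eval-FP Γ H v l)) (sym (eval-FP Γ H v r))
      (th-ax ax v λ {e} e∈ →
        subst₂ (ThQ Γ H) (eval-FP Γ H v (proj₁ e)) (eval-FP Γ H v (proj₂ e)) (ps e∈))

  sub-cong : ∀ {n m r} {H : List (Eqn n)} {R : Rel (Term n) r} → IsCongruence (FP Γ n H) R →
             {σ τ : Fin m → Term n} → (∀ i → R (σ i) (τ i)) → ∀ t → R (sub σ t) (sub τ t)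
  sub-cong R-cong σRτ (var i)     = σRτ i
  sub-cong R-cong σRτ (bin o s t) = θ-op o (sub-cong R-cong σRτ s) (sub-cong R-cong σRτ t)
    where open IsCongruence R-cong
  sub-cong R-cong σRτ (con k)     = IsCongruence.≈⇒θ R-cong th-refl

  sub-cong-var : ∀ {n r} {H : List (Eqn n)} {R : Rel (Term n) r} → IsCongruence (FP Γ n H) R →
                 {σ : Fin n → Term n} → (∀ i → R (σ i) (var i)) → ∀ t → R (sub σ t) t
  sub-cong-var {R = R} R-cong {σ} σRvar t = subst (R (sub σ t)) (sub-var t) (sub-cong R-cong σRvar t)

  Unifier : ∀ {n m} → List (Eqn n) → (Fin n → Term m) → Set
  Unifier H σ = ∀ {s t} → (s , t) ∈ H → ThQ Γ [] (sub σ s) (sub σ t)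

  IsProjectiveUnifier : ∀ {n} → List (Eqn n) → (Fin n → Term n) → Set
  IsProjectiveUnifier H σ = Unifier H σ × (∀ i → ThQ Γ H (σ i) (var i))

  hom⇒unifier : ∀ {n m} {H : List (Eqn n)} (u : Hom (FP Γ n H) (FP Γ m [])) →
                Unifier H (fun u ∘ var)
  hom⇒unifier {H = H} u {s} {t} s≈t∈H =
    th-trans (th-sym (u-sub s)) (th-trans (fun-cong u (hyp s≈t∈H)) (u-sub t))
    where
    u-sub : ∀ t → ThQ Γ [] (fun u t) (sub (fun u ∘ var) t)
    u-sub t = subst₂ (λ x y → ThQ Γ [] (fun u x) y) (eval-FP-var Γ H t) (eval-FP Γ [] _ t)
                (hom-eval u var t)

  unifier-∘ : ∀ {n m k} {H : List (Eqn n)} {σ : Fin n → Term m} (τ : Fin m → Term k) →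
              Unifier H σ → Unifier H (sub τ ∘ σ)
  unifier-∘ {σ = σ} τ σ-unif {s} {t} s≈t∈H =
    subst₂ (ThQ Γ []) (sub-sub τ σ s) (sub-sub τ σ t) (ThQ-sub τ (λ ()) (σ-unif s≈t∈H))

  -- F/H is a retract of F, the retraction being the substitution σ.
  projectiveUnifier⇒projective : ∀ {n} {H : List (Eqn n)} {σ : Fin n → Term n} →
                                 IsProjectiveUnifier H σ → Projective Γ (FP Γ n H)
  projectiveUnifier⇒projective {n} {H} {σ} (σ-unif , σ≈var) B C B∈Q C∈Q g g-onto f = h , g∘h≈f
    where
    lift : Fin n → Carrier B
    lift i = proj₁ (g-onto (fun f (var i)))

    h : Hom (FP Γ n H) B
    h = record
      { fun     = eval B lift ∘ sub σ
      ; fun-cong = ThQ-sound B B∈Q lift ∘ ThQ-sub σ σ-unif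
      ; fun-op  = λ _ _ _ → ≈-refl B
      ; fun-cst = λ _ → ≈-refl B
      }

    g∘h≈f : ∀ x → _≈_ C (fun g (fun h x)) (fun f x)
    g∘h≈f x = begin
      fun g (eval B lift (sub σ x))         ≈⟨ hom-eval g lift (sub σ x) ⟩
      eval C (fun g ∘ lift) (sub σ x)       ≈⟨ eval-cong C (proj₂ ∘ g-onto ∘ fun f ∘ var) (sub σ x) ⟩
      eval C (fun f ∘ var) (sub σ x)        ≈⟨ hom-eval f var (sub σ x) ⟨
      fun f (eval (FP Γ n H) var (sub σ x)) ≡⟨ cong (fun f) (eval-FP-var Γ H (sub σ x)) ⟩
      fun f (sub σ x)                       ≈⟨ fun-cong f σx≈x ⟩
      fun f x                               ∎
      where
      open SetoidReasoning (algSetoid C)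
      σx≈x : ThQ Γ H (sub σ x) x
      σx≈x = sub-cong-var (ThQ-isCongruence H) σ≈var x

biresidualMeet : ∀ {n} → List (Eqn n) → Term n
biresidualMeet []            = con one
biresidualMeet ((s , t) ∷ H) = bin meet (bin meet (bin ldiv s t) (bin ldiv t s)) (biresidualMeet H)

module FLw (Γ : QId → Set) {c ℓ} (A : Alg c ℓ) (A∈Q : InQ Γ A) where

  infixl 8 _·_
  infixr 7 _⧹_
  infixl 6 _⊓_
  infixl 5 _⊔_
  infix  4 _≤_

  _⊓_ _⊔_ _·_ _⧹_ : Carrier A → Carrier A → Carrier A
  x ⊓ y = op A meet x y
  x ⊔ y = op A join x y
  x · y = op A mul x y
  x ⧹ y = op A ldiv x y

  𝟙 : Carrier A
  𝟙 = cst A one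

  _≤_ : Carrier A → Carrier A → Set ℓ
  x ≤ y = _≈_ A (x ⊓ y) x

  private
    infix  4 _≋_
    infixr 3 _⟨≈⟩_

    _≋_ : Carrier A → Carrier A → Set ℓ
    _≋_ = _≈_ A

    ≋-refl : ∀ {x} → x ≋ x
    ≋-refl = ≈-refl A

    ≋-sym : ∀ {x y} → x ≋ y → y ≋ x
    ≋-sym = ≈-sym A

    _⟨≈⟩_ : ∀ {x y z} → x ≋ y → y ≋ z → x ≋ z
    _⟨≈⟩_ = ≈-trans A

    valuation : Carrier A → Carrier A → Carrier A → Fin 3 → Carrier A
    valuation x y z fzero               = x
    valuation x y z (fsuc fzero)        = y
    valuation x y z (fsuc (fsuc fzero)) = z

  ⊓-comm : ∀ x y → (x ⊓ y) ≋ (y ⊓ x)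
  ⊓-comm x y = A∈Q (inj₁ ∧-comm) (valuation x y x) λ ()

  ⊓-assoc : ∀ x y z → (x ⊓ y ⊓ z) ≋ (x ⊓ (y ⊓ z))
  ⊓-assoc x y z = A∈Q (inj₁ ∧-assoc) (valuation x y z) λ ()

  ⊔-absorbs-⊓ : ∀ x y → (x ⊔ x ⊓ y) ≋ x
  ⊔-absorbs-⊓ x y = A∈Q (inj₁ ∨-absorb) (valuation x y x) λ ()

  ⊓-absorbs-⊔ : ∀ x y → (x ⊓ (x ⊔ y)) ≋ x
  ⊓-absorbs-⊔ x y = A∈Q (inj₁ ∧-absorb) (valuation x y x) λ ()

  ·-identityʳ : ∀ x → (x · 𝟙) ≋ x
  ·-identityʳ x = A∈Q (inj₁ ·-idʳ) (valuation x x x) λ ()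

  x≤𝟙 : ∀ x → x ≤ 𝟙
  x≤𝟙 x = A∈Q (inj₁ top) (valuation x x x) λ ()

  residuated : ∀ {x y z} → x · y ≤ z → y ≤ x ⧹ z
  residuated {x} {y} {z} xy≤z = A∈Q (inj₁ res₁) (valuation x y z) λ { (here refl) → xy≤z }

  residuated⁻¹ : ∀ {x y z} → y ≤ x ⧹ z → x · y ≤ z
  residuated⁻¹ {x} {y} {z} y≤x⧹z = A∈Q (inj₁ res₂) (valuation x y z) λ { (here refl) → y≤x⧹z }

  ⊓-idem : ∀ x → (x ⊓ x) ≋ x
  ⊓-idem x = op-cong A meet ≋-refl (≋-sym (⊔-absorbs-⊓ x x)) ⟨≈⟩ ⊓-absorbs-⊔ x (x ⊓ x)

  ≤-antisym : ∀ {x y} → x ≤ y → y ≤ x → x ≋ y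
  ≤-antisym x≤y y≤x = ≋-sym x≤y ⟨≈⟩ ⊓-comm _ _ ⟨≈⟩ y≤x

  ≤-trans : ∀ {x y z} → x ≤ y → y ≤ z → x ≤ z
  ≤-trans {x} {y} {z} x≤y y≤z =
    op-cong A meet (≋-sym x≤y) ≋-refl ⟨≈⟩ ⊓-assoc x y z ⟨≈⟩ op-cong A meet ≋-refl y≤z ⟨≈⟩ x≤y

  x⊓y≤x : ∀ x y → x ⊓ y ≤ x
  x⊓y≤x x y = ⊓-assoc x y x ⟨≈⟩ op-cong A meet ≋-refl (⊓-comm y x)
          ⟨≈⟩ ≋-sym (⊓-assoc x x y) ⟨≈⟩ op-cong A meet (⊓-idem x) ≋-refl

  x⊓y≤y : ∀ x y → x ⊓ y ≤ y
  x⊓y≤y x y = ⊓-assoc x y y ⟨≈⟩ op-cong A meet ≋-refl (⊓-idem y)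

  𝟙⊓x≈x : ∀ x → (𝟙 ⊓ x) ≋ x
  𝟙⊓x≈x x = ⊓-comm 𝟙 x ⟨≈⟩ x≤𝟙 x

  𝟙≤x⧹x : ∀ x → 𝟙 ≤ x ⧹ x
  𝟙≤x⧹x x = residuated (op-cong A meet (·-identityʳ x) ≋-refl ⟨≈⟩ ⊓-idem x ⟨≈⟩ ≋-sym (·-identityʳ x))

  x·x⧹y≤y : ∀ x y → x · (x ⧹ y) ≤ y
  x·x⧹y≤y x y = residuated⁻¹ (⊓-idem (x ⧹ y))

  ≈⇒⧹≈𝟙 : ∀ {x y} → x ≋ y → (x ⧹ y) ≋ 𝟙
  ≈⇒⧹≈𝟙 {x} x≈y = ≤-antisym (x≤𝟙 _) (op-cong A meet ≋-refl (op-cong A ldiv ≋-refl (≋-sym x≈y)) ⟨≈⟩ 𝟙≤x⧹x x)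

  ⊓-𝟙 : ∀ {x y} → x ≋ 𝟙 → y ≋ 𝟙 → (x ⊓ y) ≋ 𝟙
  ⊓-𝟙 x≈𝟙 y≈𝟙 = op-cong A meet x≈𝟙 y≈𝟙 ⟨≈⟩ ⊓-idem 𝟙

  biresidualMeet≈𝟙 : ∀ {n} (v : Fin n → Carrier A) (H : List (Eqn n)) →
                     (∀ {s t} → (s , t) ∈ H → eval A v s ≋ eval A v t) → eval A v (biresidualMeet H) ≋ 𝟙
  biresidualMeet≈𝟙 v []            v⊨H = ≋-refl
  biresidualMeet≈𝟙 v ((s , t) ∷ H) v⊨H =
    ⊓-𝟙 (⊓-𝟙 (≈⇒⧹≈𝟙 (v⊨H (here refl))) (≈⇒⧹≈𝟙 (≋-sym (v⊨H (here refl)))))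
        (biresidualMeet≈𝟙 v H (v⊨H ∘ there))

  biresidualMeet≤ : ∀ {n} (v : Fin n → Carrier A) (H : List (Eqn n)) {s t} → (s , t) ∈ H →
                    let u = eval A v (biresidualMeet H); a = eval A v s; b = eval A v t in
                    u ≤ a ⧹ b × u ≤ b ⧹ a
  biresidualMeet≤ v ((s , t) ∷ H) (here refl) =
    ≤-trans (x⊓y≤x _ _) (x⊓y≤x _ _) , ≤-trans (x⊓y≤x _ _) (x⊓y≤y _ _)
  biresidualMeet≤ v ((s , t) ∷ H) (there p) =
    ≤-trans (x⊓y≤y _ _) (proj₁ (biresidualMeet≤ v H p)) , ≤-trans (x⊓y≤y _ _) (proj₂ (biresidualMeet≤ v H p))

  -- Modulo Cg(u, 1) we have a\b ≡ 1, so a ≡ a·(a\b) = a·(a\b) ∧ b ≡ a ∧ b.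
  Cg-≤⧹ : ∀ {u a b} → u ≤ a ⧹ b → Cg A u 𝟙 a (a ⊓ b)
  Cg-≤⧹ {u} {a} {b} u≤a⧹b = begin
    a               ≈⟨ cg-≈ (·-identityʳ a) ⟨
    a · 𝟙           ≈⟨ cg-op mul (cg-≈ ≋-refl) a⧹b∼𝟙 ⟨
    a · (a ⧹ b)     ≈⟨ cg-≈ (x·x⧹y≤y a b) ⟨
    a · (a ⧹ b) ⊓ b ≈⟨ cg-op meet (cg-op mul (cg-≈ ≋-refl) a⧹b∼𝟙) (cg-≈ ≋-refl) ⟩
    a · 𝟙 ⊓ b       ≈⟨ cg-≈ (op-cong A meet (·-identityʳ a) ≋-refl) ⟩
    a ⊓ b           ∎
    where
    open SetoidReasoning (congruenceSetoid A (Cg-isCongruence A u 𝟙))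
    a⧹b∼𝟙 : Cg A u 𝟙 (a ⧹ b) 𝟙
    a⧹b∼𝟙 = begin
      a ⧹ b     ≈⟨ cg-≈ (𝟙⊓x≈x (a ⧹ b)) ⟨
      𝟙 ⊓ a ⧹ b ≈⟨ cg-op meet (cg-sym cg-base) (cg-≈ ≋-refl) ⟩
      u ⊓ a ⧹ b ≈⟨ cg-≈ u≤a⧹b ⟩
      u         ≈⟨ cg-base ⟩
      𝟙         ∎

  Cg-≤biresidual : ∀ {u a b} → u ≤ a ⧹ b → u ≤ b ⧹ a → Cg A u 𝟙 a b
  Cg-≤biresidual u≤a⧹b u≤b⧹a =
    cg-trans (Cg-≤⧹ u≤a⧹b) (cg-trans (cg-≈ (⊓-comm _ _)) (cg-sym (Cg-≤⧹ u≤b⧹a)))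

  Cg-biresidualMeet : ∀ {n} (v : Fin n → Carrier A) (H : List (Eqn n)) {s t} → (s , t) ∈ H →
                      Cg A (eval A v (biresidualMeet H)) 𝟙 (eval A v s) (eval A v t)
  Cg-biresidualMeet v H s≈t∈H =
    Cg-≤biresidual (proj₁ (biresidualMeet≤ v H s≈t∈H)) (proj₂ (biresidualMeet≤ v H s≈t∈H))

module PrincipalSplitting {Γ : QId → Set} {n : ℕ} (H : List (Eqn n)) where

  F : Alg 0ℓ 0ℓ
  F = FP Γ n []

  a : Term n
  a = eval F var (biresidualMeet H)

  θ : Rel (Term n) 0ℓ
  θ = Cg F a (con one)

  θ-cong : IsCongruence F θ
  θ-cong = Cg-isCongruence F a (con one)

  H⊆θ : ∀ {s t} → (s , t) ∈ H → θ s t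
  H⊆θ {s} {t} s≈t∈H = subst₂ θ (eval-FP-var Γ [] s) (eval-FP-var Γ [] t)
    (FLw.Cg-biresidualMeet Γ F (FP-inQ Γ n []) var H s≈t∈H)

  θ⊆H : ∀ {x y} → θ x y → ThQ Γ H x y
  θ⊆H = Cg-least F (ThQ-isCongruence Γ H) a≈𝟙
    where
    var⊨H : ∀ {s t} → (s , t) ∈ H → ThQ Γ H (eval (FP Γ n H) var s) (eval (FP Γ n H) var t)
    var⊨H {s} {t} s≈t∈H =
      subst₂ (ThQ Γ H) (sym (eval-FP-var Γ H s)) (sym (eval-FP-var Γ H t)) (hyp s≈t∈H)
    a≈𝟙 : ThQ Γ H a (con one)
    a≈𝟙 = subst (λ x → ThQ Γ H x (con one))
      (trans (eval-FP-var Γ H (biresidualMeet H)) (sym (eval-FP-var Γ [] (biresidualMeet H))))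
      (FLw.biresidualMeet≈𝟙 Γ (FP Γ n H) (FP-inQ Γ n H) var H var⊨H)

  module _ (u : Unifiable Γ (FP Γ n H)) {θ' : Rel (Term n) 0ℓ} (θ'-cong : IsCongruence F θ')
           (θ∨θ'≡1 : ∀ x y → JoinC F θ θ' x y) (θ∧θ'≡0 : ∀ x y → θ x y → θ' x y → ThQ Γ [] x y)
           (θ'θ⊆θθ' : ∀ x y → _∘ᵣ_ F θ' θ x y → _∘ᵣ_ F θ θ' x y) where

    c : Fin n → Term n
    c = sub (λ ()) ∘ fun u ∘ var

    c-unifier : Unifier Γ H c
    c-unifier = unifier-∘ Γ (λ ()) (hom⇒unifier Γ u)

    split : ∀ i → _∘ᵣ_ F θ θ' (var i) (c i)
    split i = join⇒composite F θ-cong θ'-cong θ'θ⊆θθ' (θ∨θ'≡1 (var i) (c i))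

    σ : Fin n → Term n
    σ = proj₁ ∘ split

    σ≈var : ∀ i → ThQ Γ H (σ i) (var i)
    σ≈var i = θ⊆H (cg-sym (proj₁ (proj₂ (split i))))

    σ-unifier : Unifier Γ H σ
    σ-unifier {s} {t} s≈t∈H = θ∧θ'≡0 (sub σ s) (sub σ t)
      (cg-trans (σ-θ s) (cg-trans (H⊆θ s≈t∈H) (cg-sym (σ-θ t))))
      (θ'-trans (σ-θ'-c s) (θ'-trans (≈⇒θ' (c-unifier s≈t∈H)) (θ'-sym (σ-θ'-c t))))
      where
      open IsCongruence θ'-cong renaming (≈⇒θ to ≈⇒θ'; θ-sym to θ'-sym; θ-trans to θ'-trans)
      σ-θ : ∀ t → θ (sub σ t) t
      σ-θ = sub-cong-var Γ θ-cong (cg-sym ∘ proj₁ ∘ proj₂ ∘ split)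
      σ-θ'-c : ∀ t → θ' (sub σ t) (sub c t)
      σ-θ'-c = sub-cong Γ θ'-cong (proj₂ ∘ proj₂ ∘ split)

    projectiveUnifier : ∃ (IsProjectiveUnifier Γ H)
    projectiveUnifier = σ , σ-unifier , σ≈var

principalFactor⇒projectiveUnifier : ∀ {Γ n} {H : List (Eqn n)} → PrincipalFactor Γ →
                                    Unifiable Γ (FP Γ n H) → ∃ (IsProjectiveUnifier Γ H)
principalFactor⇒projectiveUnifier {Γ} {n} {H} principalFactor u =
  fromFactor (principalFactor F (FP-inQ Γ n []) a (con one))
  where
  open PrincipalSplitting H
  fromFactor : IsFactor F θ → ∃ (IsProjectiveUnifier Γ H)
  fromFactor (_ , θ'-cong , θ∨θ'≡1 , θ∧θ'≡0 , _ , θ'θ⊆θθ') =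
    projectiveUnifier u θ'-cong θ∨θ'≡1 θ∧θ'≡0 θ'θ⊆θθ'

theorem5p16 : (Γ : QId → Set) → PrincipalFactor Γ → HasProjectiveUnifiers Γ
theorem5p16 Γ principalFactor n H unifiable =
  projectiveUnifier⇒projective Γ (proj₂ (principalFactor⇒projectiveUnifier principalFactor unifiable))
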